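{- Let $X$ be a set of program states, $G \subseteq X$ a loop guard and $T \subseteq X \times X$ a transition relation that is deterministic, i.e. $\forall x .\ \exists x' .\ T(x,x') \wedge \forall x'' .\ (T(x,x'') \rightarrow x'' = x')$. Then the formula [ONT] $$\exists N \subseteq X, \exists x_0 \in X .\ \forall x .\ \exists x' .\ N(x_0) \wedge \big(N(x) \rightarrow G(x)\big) \wedge \big(N(x) \rightarrow T(x,x') \wedge N(x')\big)$$ is satisfiable if and only if the formula [CNT] $$\exists N \subseteq X, \exists x_0 \in X .\ \forall x, x' .\ N(x_0) \wedge \big(N(x) \rightarrow G(x)\big) \wedge \big(N(x) \wedge T(x,x') \rightarrow N(x')\big)$$ is satisfiable.
   Context: $G(x)$ means $x \in G$, $N(x)$ means $x\in N$, and $T(x,x')$ means $(x,x')\in T$. Quantifiers over $x,x',x''$ range over $X$. A witness $N$ of [CNT] is called a closed recurrence set. -}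

module Defs where

open import Data.Product using (Σ; _×_)
open import Relation.Binary.PropositionalEquality using (_≡_)

Deterministic : {X : Set} → (X → X → Set) → Set
Deterministic {X} T = (x : X) → Σ X λ x' → T x x' × ((x'' : X) → T x x'' → x'' ≡ x')

ONT : {X : Set} → (X → Set) → (X → X → Set) → Set₁
ONT {X} G T =
  Σ (X → Set) λ N → Σ X λ x₀ → (x : X) → Σ X λ x' →
    N x₀ × (N x → G x) × (N x → T x x' × N x')

CNT : {X : Set} → (X → Set) → (X → X → Set) → Set₁
CNT {X} G T =
  Σ (X → Set) λ N → Σ X λ x₀ → (x x' : X) →
    N x₀ × (N x → G x) × (N x × T x x' → N x')

module Submission where

open import Defs
open import Data.Product using (Σ; _×_; _,_; proj₁; proj₂)
open import Relation.Binary.PropositionalEquality using (_≡_; subst; trans; sym)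

-- The two directions use different halves of determinism: an open recurrence set
-- is closed because every transition out of it is the one it prescribes, and a
-- closed recurrence set is open because every state has some transition.

module _ {X : Set} (T : X → X → Set) where

  Total : Set
  Total = (x : X) → Σ X λ x' → T x x'

  Functional : Set
  Functional = (x : X) (y z : X) → T x y → T x z → y ≡ z

  Deterministic⇒Total : Deterministic T → Total
  Deterministic⇒Total det x = proj₁ (det x) , proj₁ (proj₂ (det x))

  Deterministic⇒Functional : Deterministic T → Functional
  Deterministic⇒Functional det x y z Txy Txz =
    trans (unique y Txy) (sym (unique z Txz))
    where unique = proj₂ (proj₂ (det x))

module _ {X : Set} {G : X → Set} {T : X → X → Set} where

  ONT⇒CNT : Functional T → ONT G T → CNT G T
  ONT⇒CNT functional (N , x₀ , open-rec) = N , x₀ , λ x x' →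
    let (y , N-x₀ , N⇒G , N⇒step) = open-rec x in
    N-x₀ , N⇒G , λ (Nx , Txx') →
      let (Txy , Ny) = N⇒step Nx
      in subst N (functional x y x' Txy Txx') Ny

  CNT⇒ONT : Total T → CNT G T → ONT G T
  CNT⇒ONT total (N , x₀ , closed-rec) = N , x₀ , λ x →
    let (x' , Txx') = total x
        (N-x₀ , N⇒G , _) = closed-rec x x
        (_ , _ , N-closed) = closed-rec x x'
    in x' , N-x₀ , N⇒G , λ Nx → Txx' , N-closed (Nx , Txx')

theorem4 : (X : Set) (G : X → Set) (T : X → X → Set) →
    Deterministic T → (ONT G T → CNT G T) × (CNT G T → ONT G T)
theorem4 X G T det =
  ONT⇒CNT (Deterministic⇒Functional T det) , CNT⇒ONT (Deterministic⇒Total T det)
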